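{- Let $\mathcal A$ be a reduced $k$-uniform hypergraph with index set $I$, vertex classes $\mathcal P_x$ ($x\in I^{(k-1)}$) and constituents $\mathcal A_y$ ($y\in I^{(k)}$). A set $z\in I^{(k+1)}$ supports an $F^{(k)}$ if there exist three distinct $k$-sets $y_1,y_2,y_3\in z^{(k)}$ and edges $e_1\in E(\mathcal A_{y_1})$, $e_2\in E(\mathcal A_{y_2})$, $e_3\in E(\mathcal A_{y_3})$ no two of which are disjoint.
   Context: Let $k\ge 2$. A reduced $k$-uniform hypergraph is given by: a finite index set $I$; for each $x\in I^{(k-1)}$ a finite nonempty set $\mathcal P_x$ (the vertex classes), pairwise disjoint for distinct $x$; and for each $y\in I^{(k)}$ a $k$-partite $k$-uniform hypergraph $\mathcal A_y$ (a constituent) with vertex partition $\bigcup_{x\in y^{(k-1)}}\mathcal P_x$, i.e., each edge of $\mathcal A_y$ contains exactly one vertex from each $\mathcal P_x$ with $x\in y^{(k-1)}$. A set $z\in I^{(k+1)}$ supports an $F^{(k)}$ if one can select for every $x\in z^{(k-1)}$ an element $P_x\in\mathcal P_x$ such that there are at least three sets $y\in z^{(k)}$ with $\{P_x\colon x\in y^{(k-1)}\}\in E(\mathcal A_y)$. -}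

module Defs where

open import Data.Nat using (ℕ; suc; _∸_; _≥_)
open import Data.Fin using (Fin)
open import Data.Fin.Subset using (Subset; _∈_; _⊆_; _∩_; ∣_∣; Nonempty; Empty)
open import Data.Product using (Σ; ∃; _×_; _,_)
open import Relation.Binary.PropositionalEquality using (_≡_; _≢_)
open import Function.Bundles using (_⇔_)

-- The index set I is Fin n; vertices of the reduced hypergraph live in Fin m.
-- I^(j) = subsets x of Fin n with ∣ x ∣ ≡ j.

IsPartiteEdge : ∀ {n m} (k : ℕ) (P : Subset n → Subset m) (y : Subset n) (e : Subset m) → Set
IsPartiteEdge {n} {m} k P y e =
  (∀ (v : Fin m) → v ∈ e → ∃ λ (x : Subset n) → x ⊆ y × ∣ x ∣ ≡ k ∸ 1 × v ∈ P x)
  × (∀ (x : Subset n) → x ⊆ y → ∣ x ∣ ≡ k ∸ 1 →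
       ∃ λ (v : Fin m) → v ∈ e × v ∈ P x × (∀ (w : Fin m) → w ∈ e → w ∈ P x → w ≡ v))

record ReducedHypergraph (k n m : ℕ) : Set₁ where
  field
    -- vertex classes P_x (only meaningful for ∣ x ∣ ≡ k ∸ 1)
    P : Subset n → Subset m
    -- constituents: A y e means e ∈ E(A_y) (only meaningful for ∣ y ∣ ≡ k)
    A : Subset n → Subset m → Set
    P-nonempty : ∀ x → ∣ x ∣ ≡ k ∸ 1 → Nonempty (P x)
    P-disjoint : ∀ x x′ → ∣ x ∣ ≡ k ∸ 1 → ∣ x′ ∣ ≡ k ∸ 1 → x ≢ x′ → Empty (P x ∩ P x′)
    A-partite : ∀ y e → ∣ y ∣ ≡ k → A y e → IsPartiteEdge k P y e

module _ {k n m : ℕ} (H : ReducedHypergraph k n m) where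
  open ReducedHypergraph H

  IsImage : (Subset n → Fin m) → Subset n → Subset m → Set
  IsImage Q y e = ∀ (v : Fin m) → v ∈ e ⇔ (∃ λ x → x ⊆ y × ∣ x ∣ ≡ k ∸ 1 × Q x ≡ v)

  ImageIsEdge : (Subset n → Fin m) → Subset n → Set
  ImageIsEdge Q y = ∃ λ e → IsImage Q y e × A y e

  IsKSubsetOf : Subset n → Subset n → Set
  IsKSubsetOf y z = y ⊆ z × ∣ y ∣ ≡ k

  SupportsF : Subset n → Set
  SupportsF z =
    ∃ λ (Q : Subset n → Fin m) →
      (∀ x → x ⊆ z → ∣ x ∣ ≡ k ∸ 1 → Q x ∈ P x)
      × (∃ λ y₁ → ∃ λ y₂ → ∃ λ y₃ →
           IsKSubsetOf y₁ z × IsKSubsetOf y₂ z × IsKSubsetOf y₃ z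
           × y₁ ≢ y₂ × y₁ ≢ y₃ × y₂ ≢ y₃
           × ImageIsEdge Q y₁ × ImageIsEdge Q y₂ × ImageIsEdge Q y₃)

  ThreePairwiseIntersectingEdges : Subset n → Set
  ThreePairwiseIntersectingEdges z =
    ∃ λ y₁ → ∃ λ y₂ → ∃ λ y₃ →
      IsKSubsetOf y₁ z × IsKSubsetOf y₂ z × IsKSubsetOf y₃ z
      × y₁ ≢ y₂ × y₁ ≢ y₃ × y₂ ≢ y₃
      × (∃ λ e₁ → ∃ λ e₂ → ∃ λ e₃ →
           A y₁ e₁ × A y₂ e₂ × A y₃ e₃
           × Nonempty (e₁ ∩ e₂) × Nonempty (e₁ ∩ e₃) × Nonempty (e₂ ∩ e₃))

{-# OPTIONS --safe #-}
module Submission where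

-- Two distinct k-sets y, y′ inside a (k+1)-set share exactly one (k−1)-subset, y ∩ y′.
-- So if the edges of A_y and A_y′ are images of one selection, they meet in its vertex of
-- 𝒫_{y ∩ y′}. Conversely, a vertex common to edges of A_y and A_y′ lies in a class 𝒫_x with
-- x ⊆ y and in a class 𝒫_x′ with x′ ⊆ y′; the classes being disjoint, x = x′ = y ∩ y′, so
-- both edges use the same vertex of 𝒫_{y ∩ y′}. Three pairwise intersecting edges thus agree
-- on every shared class and glue to one selection whose image on each y_i is its edge.

open import Defs
open import Data.Nat using (ℕ; zero; suc; _≥_; _≤_; _∸_; _+_; s≤s; _≤?_; _≟_)
open import Data.Nat.Properties
  using (≤-antisym; ≤-trans; ≤-reflexive; ≰⇒>; <⇒≱; +-suc; +-cancelˡ-≡; suc-injective)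
open import Data.Fin using (Fin)
open import Data.Fin.Subset using (Subset; ∣_∣; _∈_; _⊆_; _∩_; _∪_; Nonempty; inside; outside)
open import Data.Fin.Subset.Properties
  using (drop-∷-⊆; p⊆q⇒∣p∣≤∣q∣; p⊆p∪q; q⊆p∪q; x∈p∪q⁻; p∩q⊆p; p∩q⊆q; x∈p∩q⁺; x∈p∩q⁻; _⊆?_)
open import Data.Vec using ([]; _∷_; here)
open import Data.Vec.Properties using (≡-dec)
import Data.Bool.Properties as Bool
open import Data.Product using (∃; _×_; _,_; proj₁; proj₂)
open import Data.Sum using (inj₁; inj₂)
open import Relation.Nullary using (yes; no; ¬_; contradiction)
open import Relation.Nullary.Decidable using (_×-dec_)
open import Relation.Unary using (Decidable)
open import Relation.Binary.PropositionalEquality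
  using (_≡_; _≢_; refl; sym; trans; cong; cong₂; subst; module ≡-Reasoning)
open import Function.Bundles using (_⇔_; mk⇔; Equivalence)

p⊆q∧∣q∣≤∣p∣⇒p≡q : ∀ {n} {p q : Subset n} → p ⊆ q → ∣ q ∣ ≤ ∣ p ∣ → p ≡ q
p⊆q∧∣q∣≤∣p∣⇒p≡q {p = []}          {[]}          _   _         = refl
p⊆q∧∣q∣≤∣p∣⇒p≡q {p = outside ∷ p} {outside ∷ q} p⊆q ∣q∣≤∣p∣   =
  cong (outside ∷_) (p⊆q∧∣q∣≤∣p∣⇒p≡q (drop-∷-⊆ p⊆q) ∣q∣≤∣p∣)
p⊆q∧∣q∣≤∣p∣⇒p≡q {p = outside ∷ p} {inside ∷ q}  p⊆q ∣q∣≤∣p∣   =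
  contradiction ∣q∣≤∣p∣ (<⇒≱ (s≤s (p⊆q⇒∣p∣≤∣q∣ (drop-∷-⊆ p⊆q))))
p⊆q∧∣q∣≤∣p∣⇒p≡q {p = inside ∷ p}  {outside ∷ q} p⊆q _         with p⊆q here
... | ()
p⊆q∧∣q∣≤∣p∣⇒p≡q {p = inside ∷ p}  {inside ∷ q}  p⊆q (s≤s ∣q∣≤∣p∣) =
  cong (inside ∷_) (p⊆q∧∣q∣≤∣p∣⇒p≡q (drop-∷-⊆ p⊆q) ∣q∣≤∣p∣)

∣p∪q∣+∣p∩q∣≡∣p∣+∣q∣ : ∀ {n} (p q : Subset n) → ∣ p ∪ q ∣ + ∣ p ∩ q ∣ ≡ ∣ p ∣ + ∣ q ∣
∣p∪q∣+∣p∩q∣≡∣p∣+∣q∣ []            []            = refl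
∣p∪q∣+∣p∩q∣≡∣p∣+∣q∣ (outside ∷ p) (outside ∷ q) = ∣p∪q∣+∣p∩q∣≡∣p∣+∣q∣ p q
∣p∪q∣+∣p∩q∣≡∣p∣+∣q∣ (inside ∷ p)  (outside ∷ q) = cong suc (∣p∪q∣+∣p∩q∣≡∣p∣+∣q∣ p q)
∣p∪q∣+∣p∩q∣≡∣p∣+∣q∣ (outside ∷ p) (inside ∷ q)  =
  trans (cong suc (∣p∪q∣+∣p∩q∣≡∣p∣+∣q∣ p q)) (sym (+-suc ∣ p ∣ ∣ q ∣))
∣p∪q∣+∣p∩q∣≡∣p∣+∣q∣ (inside ∷ p)  (inside ∷ q)  = cong suc (begin
  ∣ p ∪ q ∣ + suc ∣ p ∩ q ∣ ≡⟨ +-suc ∣ p ∪ q ∣ ∣ p ∩ q ∣ ⟩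
  suc (∣ p ∪ q ∣ + ∣ p ∩ q ∣) ≡⟨ cong suc (∣p∪q∣+∣p∩q∣≡∣p∣+∣q∣ p q) ⟩
  suc (∣ p ∣ + ∣ q ∣)       ≡⟨ +-suc ∣ p ∣ ∣ q ∣ ⟨
  ∣ p ∣ + suc ∣ q ∣         ∎)
  where open ≡-Reasoning

suc[k]+c≡k+k⇒c≡k∸1 : ∀ k c → suc k + c ≡ k + k → c ≡ k ∸ 1
suc[k]+c≡k+k⇒c≡k∸1 zero    c ()
suc[k]+c≡k+k⇒c≡k∸1 (suc j) c eq =
  +-cancelˡ-≡ j c j (suc-injective (trans (suc-injective eq) (+-suc j j)))

IsFacetOf : ∀ {n} → ℕ → Subset n → Subset n → Set
IsFacetOf k x y = x ⊆ y × ∣ x ∣ ≡ k ∸ 1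

facet? : ∀ {n} k (y : Subset n) → Decidable (λ x → IsFacetOf k x y)
facet? k y x = x ⊆? y ×-dec ∣ x ∣ ≟ k ∸ 1

module _ {n k : ℕ} {p q r : Subset n} (p⊆r : p ⊆ r) (q⊆r : q ⊆ r) (∣r∣≡1+k : ∣ r ∣ ≡ suc k)
         (∣p∣≡k : ∣ p ∣ ≡ k) (∣q∣≡k : ∣ q ∣ ≡ k) (p≢q : p ≢ q) where

  ∣p∪q∣≡1+k : ∣ p ∪ q ∣ ≡ suc k
  ∣p∪q∣≡1+k with ∣ p ∪ q ∣ ≤? k
  ... | yes ∣p∪q∣≤k =
    contradiction (trans (absorbs (p⊆p∪q q) ∣p∣≡k) (sym (absorbs (q⊆p∪q p q) ∣q∣≡k))) p≢q
    where
    absorbs : ∀ {s} → s ⊆ p ∪ q → ∣ s ∣ ≡ k → s ≡ p ∪ q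
    absorbs s⊆p∪q ∣s∣≡k = p⊆q∧∣q∣≤∣p∣⇒p≡q s⊆p∪q (≤-trans ∣p∪q∣≤k (≤-reflexive (sym ∣s∣≡k)))
  ... | no ∣p∪q∣≰k = ≤-antisym (≤-trans (p⊆q⇒∣p∣≤∣q∣ p∪q⊆r) (≤-reflexive ∣r∣≡1+k)) (≰⇒> ∣p∪q∣≰k)
    where
    p∪q⊆r : p ∪ q ⊆ r
    p∪q⊆r x∈p∪q with x∈p∪q⁻ p q x∈p∪q
    ... | inj₁ x∈p = p⊆r x∈p
    ... | inj₂ x∈q = q⊆r x∈q

  ∣p∩q∣≡k∸1 : ∣ p ∩ q ∣ ≡ k ∸ 1
  ∣p∩q∣≡k∸1 = suc[k]+c≡k+k⇒c≡k∸1 k ∣ p ∩ q ∣ (begin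
    suc k + ∣ p ∩ q ∣         ≡⟨ cong (_+ ∣ p ∩ q ∣) ∣p∪q∣≡1+k ⟨
    ∣ p ∪ q ∣ + ∣ p ∩ q ∣     ≡⟨ ∣p∪q∣+∣p∩q∣≡∣p∣+∣q∣ p q ⟩
    ∣ p ∣ + ∣ q ∣             ≡⟨ cong₂ _+_ ∣p∣≡k ∣q∣≡k ⟩
    k + k                     ∎)
    where open ≡-Reasoning

  p∩q-isFacet : IsFacetOf k (p ∩ q) p × IsFacetOf k (p ∩ q) q
  p∩q-isFacet = (p∩q⊆p p q , ∣p∩q∣≡k∸1) , (p∩q⊆q p q , ∣p∩q∣≡k∸1)

  common-facet≡p∩q : ∀ {x} → IsFacetOf k x p → IsFacetOf k x q → x ≡ p ∩ q
  common-facet≡p∩q (x⊆p , ∣x∣≡k∸1) (x⊆q , _) =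
    p⊆q∧∣q∣≤∣p∣⇒p≡q (λ i∈x → x∈p∩q⁺ (x⊆p i∈x , x⊆q i∈x))
                     (≤-reflexive (trans ∣p∩q∣≡k∸1 (sym ∣x∣≡k∸1)))

-- Opaque, so that the arguments of override-elim are inferred from its goal.
opaque
  override : ∀ {X A : Set} {U : X → Set} → Decidable U → ((x : X) → U x → A) → (X → A) → X → A
  override U? f d x with U? x
  ... | yes u = f x u
  ... | no _  = d x

  override-elim : ∀ {X A : Set} {U : X → Set} {U? : Decidable U} {f d x} (R : A → Set) →
                  (∀ u → R (f x u)) → (¬ U x → R (d x)) → R (override U? f d x)
  override-elim {U? = U?} {x = x} R onU offU with U? x
  ... | yes u  = onU u
  ... | no ¬u  = offU ¬u

module PartiteEdge {k n m : ℕ} {P : Subset n → Subset m} {y : Subset n} {e : Subset m}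
                   (pe : IsPartiteEdge k P y e) where

  private
    vertexIn : ∀ {x} → IsFacetOf k x y →
               ∃ λ v → v ∈ e × v ∈ P x × (∀ w → w ∈ e → w ∈ P x → w ≡ v)
    vertexIn (x⊆y , ∣x∣≡k∸1) = proj₂ pe _ x⊆y ∣x∣≡k∸1

  vertex : ∀ {x} → IsFacetOf k x y → Fin m
  vertex f = proj₁ (vertexIn f)

  vertex∈e : ∀ {x} (f : IsFacetOf k x y) → vertex f ∈ e
  vertex∈e f = proj₁ (proj₂ (vertexIn f))

  vertex∈P : ∀ {x} (f : IsFacetOf k x y) → vertex f ∈ P x
  vertex∈P f = proj₁ (proj₂ (proj₂ (vertexIn f)))

  vertex-unique : ∀ {x w} (f : IsFacetOf k x y) → w ∈ e → w ∈ P x → w ≡ vertex f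
  vertex-unique f = proj₂ (proj₂ (proj₂ (vertexIn f))) _

  vertex-irrelevant : ∀ {x} (f f′ : IsFacetOf k x y) → vertex f ≡ vertex f′
  vertex-irrelevant f f′ = vertex-unique f′ (vertex∈e f) (vertex∈P f)

  class-of : ∀ {w} → w ∈ e → ∃ λ x → IsFacetOf k x y × w ∈ P x
  class-of w∈e with proj₁ pe _ w∈e
  ... | x , x⊆y , ∣x∣≡k∸1 , w∈P = x , (x⊆y , ∣x∣≡k∸1) , w∈P

  image-of-vertex-choice : ∀ {Q : Subset n → Fin m} →
                           (∀ {x} (f : IsFacetOf k x y) → Q x ≡ vertex f) →
                           ∀ w → w ∈ e ⇔ (∃ λ x → x ⊆ y × ∣ x ∣ ≡ k ∸ 1 × Q x ≡ w)
  image-of-vertex-choice {Q} Q≡vertex w = mk⇔ to from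
    where
    to : w ∈ e → ∃ λ x → x ⊆ y × ∣ x ∣ ≡ k ∸ 1 × Q x ≡ w
    to w∈e with class-of w∈e
    ... | x , f@(x⊆y , ∣x∣≡k∸1) , w∈P =
      x , x⊆y , ∣x∣≡k∸1 , trans (Q≡vertex f) (sym (vertex-unique f w∈e w∈P))
    from : (∃ λ x → x ⊆ y × ∣ x ∣ ≡ k ∸ 1 × Q x ≡ w) → w ∈ e
    from (x , x⊆y , ∣x∣≡k∸1 , Qx≡w) =
      subst (_∈ e) (trans (sym (Q≡vertex (x⊆y , ∣x∣≡k∸1))) Qx≡w) (vertex∈e (x⊆y , ∣x∣≡k∸1))

module _ {k n m : ℕ} (H : ReducedHypergraph k n m) where
  open ReducedHypergraph H
  open module Edge {y : Subset n} {e : Subset m} = PartiteEdge {k} {n} {m} {P} {y} {e}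

  images-meet : ∀ {Q y y′ e e′ x} → IsImage H Q y e → IsImage H Q y′ e′ →
                IsFacetOf k x y → IsFacetOf k x y′ → Nonempty (e ∩ e′)
  images-meet {Q} {x = x} img img′ (x⊆y , ∣x∣≡k∸1) (x⊆y′ , _) =
    Q x , x∈p∩q⁺ ( Equivalence.from (img (Q x)) (x , x⊆y , ∣x∣≡k∸1 , refl)
                 , Equivalence.from (img′ (Q x)) (x , x⊆y′ , ∣x∣≡k∸1 , refl))

  intersecting-edges-agree :
    ∀ {y y′ e e′ c} (pe : IsPartiteEdge k P y e) (pe′ : IsPartiteEdge k P y′ e′) →
    (∀ {x} → IsFacetOf k x y → IsFacetOf k x y′ → x ≡ c) → Nonempty (e ∩ e′) →
    ∀ {x} (f : IsFacetOf k x y) (f′ : IsFacetOf k x y′) → vertex pe f ≡ vertex pe′ f′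
  intersecting-edges-agree pe pe′ unique (w , w∈e∩e′) {x} f f′ with x∈p∩q⁻ _ _ w∈e∩e′
  ... | w∈e , w∈e′ with class-of pe w∈e | class-of pe′ w∈e′
  ... | x₁ , f₁ , w∈P₁ | x₂ , f₂ , w∈P₂ with ≡-dec Bool._≟_ x₁ x₂
  ... | no x₁≢x₂ =
    contradiction (w , x∈p∩q⁺ (w∈P₁ , w∈P₂)) (P-disjoint x₁ x₂ (proj₂ f₁) (proj₂ f₂) x₁≢x₂)
  ... | yes refl = trans (sym (vertex-unique pe f w∈e w∈P)) (vertex-unique pe′ f′ w∈e′ w∈P)
    where
    w∈P : w ∈ P x
    w∈P = subst (λ t → w ∈ P t) (trans (unique f₁ f₂) (sym (unique f f′))) w∈P₁

  choose : Fin m → Subset n → Fin m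
  choose w = override (λ x → ∣ x ∣ ≟ k ∸ 1) (λ x ∣x∣≡k∸1 → proj₁ (P-nonempty x ∣x∣≡k∸1)) (λ _ → w)

  choose∈P : ∀ w {x} → ∣ x ∣ ≡ k ∸ 1 → choose w x ∈ P x
  choose∈P w {x} ∣x∣≡k∸1 =
    override-elim (_∈ P x) (λ ∣x∣≡k∸1′ → proj₂ (P-nonempty x ∣x∣≡k∸1′)) (contradiction ∣x∣≡k∸1)

  module _ {z : Subset n} (∣z∣≡1+k : ∣ z ∣ ≡ suc k) where

    images-on-distinct-k-subsets-meet :
      ∀ {Q y y′ e e′} → IsImage H Q y e → IsImage H Q y′ e′ →
      IsKSubsetOf H y z → IsKSubsetOf H y′ z → y ≢ y′ → Nonempty (e ∩ e′)
    images-on-distinct-k-subsets-meet img img′ (y⊆z , ∣y∣≡k) (y′⊆z , ∣y′∣≡k) y≢y′ =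
      let (f , f′) = p∩q-isFacet y⊆z y′⊆z ∣z∣≡1+k ∣y∣≡k ∣y′∣≡k y≢y′ in images-meet img img′ f f′

    supportsF⇒pairwiseIntersecting : SupportsF H z → ThreePairwiseIntersectingEdges H z
    supportsF⇒pairwiseIntersecting
      (Q , _ , y₁ , y₂ , y₃ , k₁ , k₂ , k₃ , y₁≢y₂ , y₁≢y₃ , y₂≢y₃ ,
       (e₁ , img₁ , a₁) , (e₂ , img₂ , a₂) , (e₃ , img₃ , a₃)) =
      y₁ , y₂ , y₃ , k₁ , k₂ , k₃ , y₁≢y₂ , y₁≢y₃ , y₂≢y₃ , e₁ , e₂ , e₃ , a₁ , a₂ , a₃ ,
      images-on-distinct-k-subsets-meet img₁ img₂ k₁ k₂ y₁≢y₂ ,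
      images-on-distinct-k-subsets-meet img₁ img₃ k₁ k₃ y₁≢y₃ ,
      images-on-distinct-k-subsets-meet img₂ img₃ k₂ k₃ y₂≢y₃

    intersecting-edges-of-distinct-k-subsets-agree :
      ∀ {y y′ e e′} (pe : IsPartiteEdge k P y e) (pe′ : IsPartiteEdge k P y′ e′) →
      IsKSubsetOf H y z → IsKSubsetOf H y′ z → y ≢ y′ → Nonempty (e ∩ e′) →
      ∀ {x} (f : IsFacetOf k x y) (f′ : IsFacetOf k x y′) → vertex pe f ≡ vertex pe′ f′
    intersecting-edges-of-distinct-k-subsets-agree pe pe′ (y⊆z , ∣y∣≡k) (y′⊆z , ∣y′∣≡k) y≢y′ =
      intersecting-edges-agree pe pe′ (common-facet≡p∩q y⊆z y′⊆z ∣z∣≡1+k ∣y∣≡k ∣y′∣≡k y≢y′)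

    pairwiseIntersecting⇒supportsF : ThreePairwiseIntersectingEdges H z → SupportsF H z
    pairwiseIntersecting⇒supportsF
      (y₁ , y₂ , y₃ , k₁ , k₂ , k₃ , y₁≢y₂ , y₁≢y₃ , y₂≢y₃ ,
       e₁ , e₂ , e₃ , a₁ , a₂ , a₃ , n₁₂ , n₁₃ , n₂₃) =
      Q , (λ x _ → Q∈P x) , y₁ , y₂ , y₃ , k₁ , k₂ , k₃ , y₁≢y₂ , y₁≢y₃ , y₂≢y₃ ,
      (e₁ , image-of-vertex-choice pe₁ Q≡v₁ , a₁) ,
      (e₂ , image-of-vertex-choice pe₂ Q≡v₂ , a₂) ,
      (e₃ , image-of-vertex-choice pe₃ Q≡v₃ , a₃)
      where
      pe₁ : IsPartiteEdge k P y₁ e₁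
      pe₁ = A-partite y₁ e₁ (proj₂ k₁) a₁
      pe₂ : IsPartiteEdge k P y₂ e₂
      pe₂ = A-partite y₂ e₂ (proj₂ k₂) a₂
      pe₃ : IsPartiteEdge k P y₃ e₃
      pe₃ = A-partite y₃ e₃ (proj₂ k₃) a₃

      agree₁₂ : ∀ {x} (f₁ : IsFacetOf k x y₁) (f₂ : IsFacetOf k x y₂) → vertex pe₁ f₁ ≡ vertex pe₂ f₂
      agree₁₂ = intersecting-edges-of-distinct-k-subsets-agree pe₁ pe₂ k₁ k₂ y₁≢y₂ n₁₂
      agree₁₃ : ∀ {x} (f₁ : IsFacetOf k x y₁) (f₃ : IsFacetOf k x y₃) → vertex pe₁ f₁ ≡ vertex pe₃ f₃
      agree₁₃ = intersecting-edges-of-distinct-k-subsets-agree pe₁ pe₃ k₁ k₃ y₁≢y₃ n₁₃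
      agree₂₃ : ∀ {x} (f₂ : IsFacetOf k x y₂) (f₃ : IsFacetOf k x y₃) → vertex pe₂ f₂ ≡ vertex pe₃ f₃
      agree₂₃ = intersecting-edges-of-distinct-k-subsets-agree pe₂ pe₃ k₂ k₃ y₂≢y₃ n₂₃

      Q : Subset n → Fin m
      Q = override (facet? k y₁) (λ _ → vertex pe₁)
            (override (facet? k y₂) (λ _ → vertex pe₂)
              (override (facet? k y₃) (λ _ → vertex pe₃)
                (choose (proj₁ n₁₂))))

      Q∈P : ∀ x → ∣ x ∣ ≡ k ∸ 1 → Q x ∈ P x
      Q∈P x ∣x∣≡k∸1 =
        override-elim (_∈ P x) (vertex∈P pe₁) λ _ →
        override-elim (_∈ P x) (vertex∈P pe₂) λ _ →
        override-elim (_∈ P x) (vertex∈P pe₃) λ _ →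
        choose∈P (proj₁ n₁₂) ∣x∣≡k∸1

      Q≡v₁ : ∀ {x} (f : IsFacetOf k x y₁) → Q x ≡ vertex pe₁ f
      Q≡v₁ f = override-elim (_≡ vertex pe₁ f) (λ f′ → vertex-irrelevant pe₁ f′ f) (contradiction f)

      Q≡v₂ : ∀ {x} (f : IsFacetOf k x y₂) → Q x ≡ vertex pe₂ f
      Q≡v₂ f =
        override-elim (_≡ vertex pe₂ f) (λ f₁ → agree₁₂ f₁ f) λ _ →
        override-elim (_≡ vertex pe₂ f) (λ f′ → vertex-irrelevant pe₂ f′ f) (contradiction f)

      Q≡v₃ : ∀ {x} (f : IsFacetOf k x y₃) → Q x ≡ vertex pe₃ f
      Q≡v₃ f =
        override-elim (_≡ vertex pe₃ f) (λ f₁ → agree₁₃ f₁ f) λ _ →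
        override-elim (_≡ vertex pe₃ f) (λ f₂ → agree₂₃ f₂ f) λ _ →
        override-elim (_≡ vertex pe₃ f) (λ f′ → vertex-irrelevant pe₃ f′ f) (contradiction f)

fact4p4 : (k n m : ℕ) → k ≥ 2 → (H : ReducedHypergraph k n m) →
    (z : Subset n) → ∣ z ∣ ≡ suc k →
    SupportsF H z ⇔ ThreePairwiseIntersectingEdges H z
fact4p4 k n m _ H z ∣z∣≡1+k =
  mk⇔ (supportsF⇒pairwiseIntersecting H ∣z∣≡1+k) (pairwiseIntersecting⇒supportsF H ∣z∣≡1+k)
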